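{- Let $(G,+)$ be an abelian group and $\Gamma \subseteq G$ a finitely generated subgroup. Let $y_1,\dots,y_n, z_1,\dots,z_n \in G$ be such that $z_1,\dots,z_n$ are linearly independent with respect to the subgroup $\Gamma_1$ of $G$ generated by $\Gamma$ together with $y_1,\dots,y_n$. Let $y_i' := y_i + z_i$ for $i = 1,\dots,n$, and let $\Gamma_1'$ be the subgroup of $G$ generated by $\Gamma$ together with $y_1',\dots,y_n'$. Then $\Gamma_1 \cap \Gamma_1' = \Gamma$.
   Context: For a subgroup $\Delta$ of an abelian group $(G,+)$, elements $z_1,\dots,z_n \in G$ are called linearly independent with respect to $\Delta$ if for all integers $k_1,\dots,k_n$, one has $\sum_{i=1}^n k_i z_i \in \Delta$ if and only if $k_1 = \cdots = k_n = 0$. -}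

module Defs where

open import Level using (Level; _⊔_)
open import Data.Nat using (ℕ; zero; suc)
open import Data.Fin using (Fin)
open import Data.Integer using (ℤ; +_; -[1+_])
open import Data.Product using (Σ; _×_)
import Data.Vec.Functional as VF
open import Function.Bundles using (_⇔_)
open import Relation.Binary.PropositionalEquality using (_≡_)
open import Algebra.Bundles using (AbelianGroup)

module _ {c ℓ : Level} (G : AbelianGroup c ℓ) where
  open AbelianGroup G renaming (_∙_ to _+_; ε to 0#; _⁻¹ to -_)

  natMul : ℕ → Carrier → Carrier
  natMul zero    x = 0#
  natMul (suc n) x = x + natMul n x

  intMul : ℤ → Carrier → Carrier
  intMul (+ n)    x = natMul n x
  intMul -[1+ n ] x = - natMul (suc n) x

  linComb : ∀ {m} → (Fin m → ℤ) → (Fin m → Carrier) → Carrier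
  linComb {zero}  k v = 0#
  linComb {suc m} k v = intMul (k Fin.zero) (v Fin.zero) + linComb (λ i → k (Fin.suc i)) (λ i → v (Fin.suc i))
    where import Data.Fin as Fin

  InSpan : ∀ {m} → (Fin m → Carrier) → Carrier → Set ℓ
  InSpan {m} v x = Σ (Fin m → ℤ) (λ k → linComb k v ≈ x)

  LinIndepWrt : ∀ {n} → (Carrier → Set ℓ) → (Fin n → Carrier) → Set ℓ
  LinIndepWrt {n} Δ z = (k : Fin n → ℤ) → Δ (linComb k z) ⇔ ((i : Fin n) → k i ≡ + 0)

{-# OPTIONS --safe #-}
module Submission where

-- If x lies in both ⟨g, y⟩ and ⟨g, y + z⟩, write x = a·(g ++ y) and x = c·(g ++ (y + z)).
-- Expanding the second expression gives x = c·(g ++ y) + d·z with d the y-part of c,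
-- so d·z = x − c·(g ++ y) lies in ⟨g, y⟩; independence of z forces d = 0,
-- and then x = c·(g ++ (y + z)) only involves the generators g.

open import Defs
open import Level using (Level)
open import Data.Nat as ℕ using (ℕ; zero; suc)
open import Data.Nat.Properties using (+-suc)
open import Data.Fin as Fin using (Fin; splitAt; _↑ˡ_; _↑ʳ_)
open import Data.Fin.Properties using (join-splitAt)
open import Data.Integer as ℤ using (ℤ; +_; -[1+_]; _⊖_)
open import Data.Integer.Properties using ([1+m]⊖[1+n]≡m⊖n)
open import Data.Product using (_×_; _,_)
open import Data.Sum.Properties using ([,]-∘; [,]-map)
open import Data.Vec.Functional using (_++_)
open import Function using (_∘_)
open import Function.Bundles using (_⇔_; mk⇔; Equivalence)
open import Relation.Binary.PropositionalEquality as ≡ using (_≡_; _≗_)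
open import Algebra.Bundles using (AbelianGroup)
import Algebra.Properties.AbelianGroup as AbelianGroupProperties
import Algebra.Properties.Group as GroupProperties
import Algebra.Properties.CommutativeSemigroup as CommutativeSemigroupProperties
import Algebra.Properties.CommutativeMonoid.Mult as CommutativeMonoidMult
import Relation.Binary.Reasoning.Setoid as SetoidReasoning

++-restrict : ∀ {a} {A : Set a} {m n} (v : Fin (m ℕ.+ n) → A) →
              (v ∘ (_↑ˡ n)) ++ (v ∘ (m ↑ʳ_)) ≗ v
++-restrict {m = m} {n} v i = ≡.trans (≡.sym ([,]-∘ v (splitAt m i))) (≡.cong v (join-splitAt m n i))

++-suc : ∀ {a} {A : Set a} {m n} (u : Fin (suc m) → A) (v : Fin n → A) →
         (u ++ v) ∘ Fin.suc ≗ (u ∘ Fin.suc) ++ v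
++-suc {m = m} u v i = [,]-map (splitAt m i)

module _ {c ℓ : Level} (G : AbelianGroup c ℓ) where

  open AbelianGroup G
  open AbelianGroupProperties G using (xyx⁻¹≈y; ⁻¹-∙-comm)
  open GroupProperties group using (ε⁻¹≈ε; ⁻¹-involutive)
  open CommutativeSemigroupProperties commutativeSemigroup using (interchange)
  open CommutativeMonoidMult commutativeMonoid using (×-congʳ; ×-homo-+; ×-distrib-+)
    renaming (_×_ to _×ₙ_)
  open SetoidReasoning setoid

  natMul≈× : ∀ n x → natMul G n x ≈ n ×ₙ x
  natMul≈× zero    x = refl
  natMul≈× (suc n) x = ∙-congˡ (natMul≈× n x)

  natMul-congʳ : ∀ n {x y} → x ≈ y → natMul G n x ≈ natMul G n y
  natMul-congʳ n {x} {y} x≈y = begin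
    natMul G n x ≈⟨ natMul≈× n x ⟩
    n ×ₙ x       ≈⟨ ×-congʳ n x≈y ⟩
    n ×ₙ y       ≈⟨ natMul≈× n y ⟨
    natMul G n y ∎

  natMul-homo-+ : ∀ x p q → natMul G (p ℕ.+ q) x ≈ natMul G p x ∙ natMul G q x
  natMul-homo-+ x p q = begin
    natMul G (p ℕ.+ q) x          ≈⟨ natMul≈× (p ℕ.+ q) x ⟩
    (p ℕ.+ q) ×ₙ x                ≈⟨ ×-homo-+ x p q ⟩
    p ×ₙ x ∙ q ×ₙ x               ≈⟨ ∙-cong (natMul≈× p x) (natMul≈× q x) ⟨
    natMul G p x ∙ natMul G q x   ∎

  natMul-distrib-∙ : ∀ n x y → natMul G n (x ∙ y) ≈ natMul G n x ∙ natMul G n y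
  natMul-distrib-∙ n x y = begin
    natMul G n (x ∙ y)            ≈⟨ natMul≈× n (x ∙ y) ⟩
    n ×ₙ (x ∙ y)                  ≈⟨ ×-distrib-+ x y n ⟩
    n ×ₙ x ∙ n ×ₙ y               ≈⟨ ∙-cong (natMul≈× n x) (natMul≈× n y) ⟨
    natMul G n x ∙ natMul G n y   ∎

  ∙⁻¹-interchange : ∀ a b c d → (a ∙ b) ∙ (c ∙ d) ⁻¹ ≈ (a ∙ c ⁻¹) ∙ (b ∙ d ⁻¹)
  ∙⁻¹-interchange a b c d = begin
    (a ∙ b) ∙ (c ∙ d) ⁻¹       ≈⟨ ∙-congˡ (⁻¹-∙-comm c d) ⟨
    (a ∙ b) ∙ (c ⁻¹ ∙ d ⁻¹)    ≈⟨ interchange a b (c ⁻¹) (d ⁻¹) ⟩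
    (a ∙ c ⁻¹) ∙ (b ∙ d ⁻¹)    ∎

  intMul-congʳ : ∀ k {x y} → x ≈ y → intMul G k x ≈ intMul G k y
  intMul-congʳ (+ n)    x≈y = natMul-congʳ n x≈y
  intMul-congʳ -[1+ n ] x≈y = ⁻¹-cong (natMul-congʳ (suc n) x≈y)

  intMul-⊖ : ∀ x p q → intMul G (p ⊖ q) x ≈ natMul G p x ∙ natMul G q x ⁻¹
  intMul-⊖ x zero    zero    = sym (trans (∙-congˡ ε⁻¹≈ε) (identityʳ _))
  intMul-⊖ x (suc p) zero    = sym (trans (∙-congˡ ε⁻¹≈ε) (identityʳ _))
  intMul-⊖ x zero    (suc q) = sym (identityˡ _)
  intMul-⊖ x (suc p) (suc q) = begin
    intMul G (suc p ⊖ suc q) x                          ≡⟨ ≡.cong (λ k → intMul G k x) ([1+m]⊖[1+n]≡m⊖n p q) ⟩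
    intMul G (p ⊖ q) x                                  ≈⟨ intMul-⊖ x p q ⟩
    natMul G p x ∙ natMul G q x ⁻¹                      ≈⟨ identityˡ _ ⟨
    ε ∙ (natMul G p x ∙ natMul G q x ⁻¹)                ≈⟨ ∙-congʳ (inverseʳ x) ⟨
    (x ∙ x ⁻¹) ∙ (natMul G p x ∙ natMul G q x ⁻¹)       ≈⟨ ∙⁻¹-interchange x (natMul G p x) x (natMul G q x) ⟨
    (x ∙ natMul G p x) ∙ (x ∙ natMul G q x) ⁻¹          ∎

  intMul-homo-+ : ∀ x k l → intMul G (k ℤ.+ l) x ≈ intMul G k x ∙ intMul G l x
  intMul-homo-+ x (+ p)    (+ q)    = natMul-homo-+ x p q
  intMul-homo-+ x (+ p)    -[1+ q ] = intMul-⊖ x p (suc q)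
  intMul-homo-+ x -[1+ p ] (+ q)    = trans (intMul-⊖ x q (suc p)) (comm _ _)
  intMul-homo-+ x -[1+ p ] -[1+ q ] = begin
    intMul G (-[1+ p ] ℤ.+ -[1+ q ]) x             ≡⟨ ≡.cong (λ n → natMul G (suc n) x ⁻¹) (+-suc p q) ⟨
    natMul G (suc p ℕ.+ suc q) x ⁻¹                ≈⟨ ⁻¹-cong (natMul-homo-+ x (suc p) (suc q)) ⟩
    (natMul G (suc p) x ∙ natMul G (suc q) x) ⁻¹   ≈⟨ ⁻¹-∙-comm _ _ ⟨
    natMul G (suc p) x ⁻¹ ∙ natMul G (suc q) x ⁻¹  ∎

  intMul-neg : ∀ x k → intMul G (ℤ.- k) x ≈ intMul G k x ⁻¹
  intMul-neg x (+ zero)  = sym ε⁻¹≈ε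
  intMul-neg x (+ suc n) = refl
  intMul-neg x -[1+ n ]  = sym (⁻¹-involutive _)

  intMul-sub : ∀ x k l → intMul G (k ℤ.- l) x ≈ intMul G k x ∙ intMul G l x ⁻¹
  intMul-sub x k l = trans (intMul-homo-+ x k (ℤ.- l)) (∙-congˡ (intMul-neg x l))

  intMul-distrib-∙ : ∀ k x y → intMul G k (x ∙ y) ≈ intMul G k x ∙ intMul G k y
  intMul-distrib-∙ (+ n)    x y = natMul-distrib-∙ n x y
  intMul-distrib-∙ -[1+ n ] x y = trans (⁻¹-cong (natMul-distrib-∙ (suc n) x y)) (sym (⁻¹-∙-comm _ _))

  linComb-cong : ∀ {m} {k l : Fin m → ℤ} {u v : Fin m → Carrier} →
                 k ≗ l → (∀ i → u i ≈ v i) → linComb G k u ≈ linComb G l v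
  linComb-cong {zero}  k≗l u≈v = refl
  linComb-cong {suc m} {k} {l} {u} {v} k≗l u≈v = ∙-cong
    (trans (intMul-congʳ (k Fin.zero) (u≈v Fin.zero))
           (reflexive (≡.cong (λ j → intMul G j (v Fin.zero)) (k≗l Fin.zero))))
    (linComb-cong (k≗l ∘ Fin.suc) (u≈v ∘ Fin.suc))

  linComb-sub : ∀ {m} (k l : Fin m → ℤ) v →
                linComb G (λ i → k i ℤ.- l i) v ≈ linComb G k v ∙ linComb G l v ⁻¹
  linComb-sub {zero}  k l v = sym (trans (∙-congˡ ε⁻¹≈ε) (identityʳ ε))
  linComb-sub {suc m} k l v = trans
    (∙-cong (intMul-sub (v Fin.zero) (k Fin.zero) (l Fin.zero))
            (linComb-sub (k ∘ Fin.suc) (l ∘ Fin.suc) (v ∘ Fin.suc)))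
    (sym (∙⁻¹-interchange _ _ _ _))

  linComb-distrib-∙ : ∀ {m} (k : Fin m → ℤ) v w →
                      linComb G k (λ i → v i ∙ w i) ≈ linComb G k v ∙ linComb G k w
  linComb-distrib-∙ {zero}  k v w = sym (identityˡ ε)
  linComb-distrib-∙ {suc m} k v w = trans
    (∙-cong (intMul-distrib-∙ (k Fin.zero) (v Fin.zero) (w Fin.zero))
            (linComb-distrib-∙ (k ∘ Fin.suc) (v ∘ Fin.suc) (w ∘ Fin.suc)))
    (interchange _ _ _ _)

  linComb-zero : ∀ {m} (k : Fin m → ℤ) v → (∀ i → k i ≡ + 0) → linComb G k v ≈ ε
  linComb-zero {zero}  k v k≗0 = refl
  linComb-zero {suc m} k v k≗0 = trans
    (∙-cong (reflexive (≡.cong (λ j → intMul G j (v Fin.zero)) (k≗0 Fin.zero)))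
            (linComb-zero (k ∘ Fin.suc) (v ∘ Fin.suc) (k≗0 ∘ Fin.suc)))
    (identityˡ ε)

  linComb-++ : ∀ {m n} (k : Fin m → ℤ) (l : Fin n → ℤ) u v →
               linComb G (k ++ l) (u ++ v) ≈ linComb G k u ∙ linComb G l v
  linComb-++ {zero}  k l u v = sym (identityˡ _)
  linComb-++ {suc m} k l u v = begin
    intMul G (k Fin.zero) (u Fin.zero) ∙ linComb G ((k ++ l) ∘ Fin.suc) ((u ++ v) ∘ Fin.suc)
      ≈⟨ ∙-congˡ (linComb-cong (++-suc k l) (reflexive ∘ ++-suc u v)) ⟩
    intMul G (k Fin.zero) (u Fin.zero) ∙ linComb G ((k ∘ Fin.suc) ++ l) ((u ∘ Fin.suc) ++ v)
      ≈⟨ ∙-congˡ (linComb-++ (k ∘ Fin.suc) l (u ∘ Fin.suc) v) ⟩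
    intMul G (k Fin.zero) (u Fin.zero) ∙ (linComb G (k ∘ Fin.suc) (u ∘ Fin.suc) ∙ linComb G l v)
      ≈⟨ assoc _ _ _ ⟨
    linComb G k u ∙ linComb G l v ∎

  linComb-split : ∀ {m n} (k : Fin (m ℕ.+ n) → ℤ) u v →
                  linComb G k (u ++ v) ≈ linComb G (k ∘ (_↑ˡ n)) u ∙ linComb G (k ∘ (m ↑ʳ_)) v
  linComb-split {m} {n} k u v = trans
    (linComb-cong (≡.sym ∘ ++-restrict {m = m} k) (λ _ → refl))
    (linComb-++ (k ∘ (_↑ˡ n)) (k ∘ (m ↑ʳ_)) u v)

  linComb-++-∙ : ∀ {m n} (k : Fin (m ℕ.+ n) → ℤ) u (v w : Fin n → Carrier) →
                 linComb G k (u ++ (λ i → v i ∙ w i)) ≈ linComb G k (u ++ v) ∙ linComb G (k ∘ (m ↑ʳ_)) w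
  linComb-++-∙ {m} {n} k u v w = begin
    linComb G k (u ++ (λ i → v i ∙ w i))               ≈⟨ linComb-split k u _ ⟩
    linComb G kᵤ u ∙ linComb G kᵥ (λ i → v i ∙ w i)    ≈⟨ ∙-congˡ (linComb-distrib-∙ kᵥ v w) ⟩
    linComb G kᵤ u ∙ (linComb G kᵥ v ∙ linComb G kᵥ w) ≈⟨ assoc _ _ _ ⟨
    (linComb G kᵤ u ∙ linComb G kᵥ v) ∙ linComb G kᵥ w ≈⟨ ∙-congʳ (linComb-split k u v) ⟨
    linComb G k (u ++ v) ∙ linComb G kᵥ w              ∎
    where
    kᵤ : Fin m → ℤ
    kᵤ = k ∘ (_↑ˡ n)
    kᵥ : Fin n → ℤ
    kᵥ = k ∘ (m ↑ʳ_)

  linComb-++-vanishingʳ : ∀ {m n} (k : Fin (m ℕ.+ n) → ℤ) u (v : Fin n → Carrier) →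
                          (∀ i → k (m ↑ʳ i) ≡ + 0) → linComb G k (u ++ v) ≈ linComb G (k ∘ (_↑ˡ n)) u
  linComb-++-vanishingʳ {m} {n} k u v k≗0 = begin
    linComb G k (u ++ v)                                         ≈⟨ linComb-split k u v ⟩
    linComb G (k ∘ (_↑ˡ n)) u ∙ linComb G (k ∘ (m ↑ʳ_)) v        ≈⟨ ∙-congˡ (linComb-zero _ v k≗0) ⟩
    linComb G (k ∘ (_↑ˡ n)) u ∙ ε                                ≈⟨ identityʳ _ ⟩
    linComb G (k ∘ (_↑ˡ n)) u                                    ∎

  linComb∈InSpan : ∀ {m} (k : Fin m → ℤ) v → InSpan G v (linComb G k v)
  linComb∈InSpan k v = k , refl

  InSpan-resp-≈ : ∀ {m} {v : Fin m → Carrier} {x y} → x ≈ y → InSpan G v x → InSpan G v y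
  InSpan-resp-≈ x≈y (k , kv≈x) = k , trans kv≈x x≈y

  InSpan-∙⁻¹ : ∀ {m} {v : Fin m → Carrier} {x y} → InSpan G v x → InSpan G v y → InSpan G v (x ∙ y ⁻¹)
  InSpan-∙⁻¹ {v = v} (k , kv≈x) (l , lv≈y) =
    (λ i → k i ℤ.- l i) , trans (linComb-sub k l v) (∙-cong kv≈x (⁻¹-cong lv≈y))

  InSpan-++⁺ˡ : ∀ {m n} {u : Fin m → Carrier} (v : Fin n → Carrier) {x} → InSpan G u x → InSpan G (u ++ v) x
  InSpan-++⁺ˡ {u = u} v (k , ku≈x) = k ++ (λ _ → + 0) , (begin
    linComb G (k ++ (λ _ → + 0)) (u ++ v)       ≈⟨ linComb-++ k _ u v ⟩
    linComb G k u ∙ linComb G (λ _ → + 0) v     ≈⟨ ∙-congˡ (linComb-zero _ v (λ _ → ≡.refl)) ⟩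
    linComb G k u ∙ ε                           ≈⟨ identityʳ _ ⟩
    linComb G k u                               ≈⟨ ku≈x ⟩
    _                                           ∎)

  ↑ʳ-coefficients-vanish : ∀ {m n} {u : Fin m → Carrier} {v w : Fin n → Carrier} →
    LinIndepWrt G (InSpan G (u ++ v)) w → ∀ {x} → InSpan G (u ++ v) x →
    ∀ k → linComb G k (u ++ (λ i → v i ∙ w i)) ≈ x → ∀ i → k (m ↑ʳ i) ≡ + 0
  ↑ʳ-coefficients-vanish {m} {u = u} {v} {w} indep {x} x∈⟨u,v⟩ k k·[u,v+w]≈x =
    Equivalence.to (indep (k ∘ (m ↑ʳ_)))
      (InSpan-resp-≈ x-k·[u,v]≈kᵥ·w (InSpan-∙⁻¹ x∈⟨u,v⟩ (linComb∈InSpan k (u ++ v))))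
    where
    x-k·[u,v]≈kᵥ·w : x ∙ linComb G k (u ++ v) ⁻¹ ≈ linComb G (k ∘ (m ↑ʳ_)) w
    x-k·[u,v]≈kᵥ·w = begin
      x ∙ linComb G k (u ++ v) ⁻¹
        ≈⟨ ∙-congʳ k·[u,v+w]≈x ⟨
      linComb G k (u ++ (λ i → v i ∙ w i)) ∙ linComb G k (u ++ v) ⁻¹
        ≈⟨ ∙-congʳ (linComb-++-∙ k u v w) ⟩
      linComb G k (u ++ v) ∙ linComb G (k ∘ (m ↑ʳ_)) w ∙ linComb G k (u ++ v) ⁻¹
        ≈⟨ xyx⁻¹≈y _ _ ⟩
      linComb G (k ∘ (m ↑ʳ_)) w
        ∎

proposition2p4 : {c ℓ : Level} (G : AbelianGroup c ℓ) (m n : ℕ)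
    (g : Fin m → AbelianGroup.Carrier G)
    (y z : Fin n → AbelianGroup.Carrier G) →
    LinIndepWrt G (InSpan G (g ++ y)) z →
    (x : AbelianGroup.Carrier G) →
    (InSpan G (g ++ y) x × InSpan G (g ++ (λ i → AbelianGroup._∙_ G (y i) (z i))) x) ⇔ InSpan G g x
proposition2p4 G m n g y z indep x = mk⇔ intersection⊆⟨g⟩ ⟨g⟩⊆intersection
  where
  open AbelianGroup G using (_∙_; trans; sym)

  intersection⊆⟨g⟩ : InSpan G (g ++ y) x × InSpan G (g ++ (λ i → y i ∙ z i)) x → InSpan G g x
  intersection⊆⟨g⟩ (x∈⟨g,y⟩ , (c , c·[g,y+z]≈x)) =
    c ∘ (_↑ˡ n) , trans (sym (linComb-++-vanishingʳ G c g _ c-vanishes-on-y)) c·[g,y+z]≈x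
    where
    c-vanishes-on-y : ∀ i → c (m ↑ʳ i) ≡ + 0
    c-vanishes-on-y = ↑ʳ-coefficients-vanish G indep x∈⟨g,y⟩ c c·[g,y+z]≈x

  ⟨g⟩⊆intersection : InSpan G g x → InSpan G (g ++ y) x × InSpan G (g ++ (λ i → y i ∙ z i)) x
  ⟨g⟩⊆intersection x∈⟨g⟩ = InSpan-++⁺ˡ G y x∈⟨g⟩ , InSpan-++⁺ˡ G _ x∈⟨g⟩
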